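{- Let $k\geq 1$ be an integer and let $G$ be a connected graph with at least 3 vertices. Then for every leaf vertex $v$ of $G$ there exists a $\gamma_{[kR]}$-function $f$ of $G$ with $f(v)\neq k+1$.
   Context: All graphs are finite and simple; a leaf is a vertex of degree 1. For $f\colon V(G)\to\mathbb{Z}_{\ge 0}$ and $S\subseteq V(G)$, $f(S)=\sum_{v\in S}f(v)$, and $AN(v)=\{w\in N(v): f(w)\ge 1\}$. A $[k]$-Roman dominating function ($[k]$-RDF) of $G$ is a function $f\colon V(G)\to\{0,1,\ldots,k+1\}$ such that $f(N[v])\ge k+|AN(v)|$ for every vertex $v$ with $f(v)<k$; its weight is $f(V(G))$. The $[k]$-Roman domination number $\gamma_{[kR]}(G)$ is the minimum weight of a $[k]$-RDF of $G$, and a $\gamma_{[kR]}$-function is a $[k]$-RDF of weight $\gamma_{[kR]}(G)$. -}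

module Defs where

open import Data.Nat using (ℕ; zero; suc; _+_; _≤_; _<_)
open import Data.Bool using (Bool; true; false; if_then_else_)
open import Data.Fin using (Fin)
open import Data.List using (List; map; allFin)
open import Data.Nat.ListAction using (sum)
open import Relation.Binary.PropositionalEquality using (_≡_)

record Graph (n : ℕ) : Set where
  field
    adj    : Fin n → Fin n → Bool
    sym    : ∀ u v → adj u v ≡ adj v u
    irrefl : ∀ v → adj v v ≡ false
open Graph public

ΣV : ∀ {n} → (Fin n → ℕ) → ℕ
ΣV {n} g = sum (map g (allFin n))

ΣN : ∀ {n} → Graph n → Fin n → (Fin n → ℕ) → ℕ
ΣN G v g = ΣV (λ w → if adj G v w then g w else 0)

degree : ∀ {n} → Graph n → Fin n → ℕ
degree G v = ΣN G v (λ _ → 1)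

IsLeaf : ∀ {n} → Graph n → Fin n → Set
IsLeaf G v = degree G v ≡ 1

data Reach {n : ℕ} (G : Graph n) : Fin n → Fin n → Set where
  here : ∀ {u} → Reach G u u
  step : ∀ {u w v} → adj G u w ≡ true → Reach G w v → Reach G u v

Connected : ∀ {n} → Graph n → Set
Connected G = ∀ u v → Reach G u v

fClosedNbhd : ∀ {n} → Graph n → (Fin n → ℕ) → Fin n → ℕ
fClosedNbhd G f v = f v + ΣN G v f

activeNbrs : ∀ {n} → Graph n → (Fin n → ℕ) → Fin n → ℕ
activeNbrs G f v = ΣN G v (λ w → positive (f w))
  where
  positive : ℕ → ℕ
  positive zero    = 0
  positive (suc _) = 1

weight : ∀ {n} → (Fin n → ℕ) → ℕ
weight = ΣV

record IsKRDF {n : ℕ} (G : Graph n) (k : ℕ) (f : Fin n → ℕ) : Set where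
  field
    bounded   : ∀ v → f v ≤ suc k
    dominates : ∀ v → f v < k → k + activeNbrs G f v ≤ fClosedNbhd G f v

record IsGammaKR {n : ℕ} (G : Graph n) (k : ℕ) (f : Fin n → ℕ) : Set where
  field
    isRDF   : IsKRDF G k f
    minimal : ∀ g → IsKRDF G k g → weight f ≤ weight g

{-# OPTIONS --safe #-}
module Submission where

-- Let u be the unique neighbour of the leaf v, and suppose a γ_[kR]-function f has f(v) = k+1.
-- Moving that label onto u (g(v) = 0, g(u) = k+1, g = f elsewhere) gives weight
-- w(f) - f(u) ≤ w(f), and g is still a [k]-RDF: v is now dominated by u alone, and at a vertex
-- w ≠ u adjacent to u the sum g(N[w]) grows by k+1 - f(u) while |AN(w)| grows only by
-- 1 - min(1, f(u)), which is no more because f(u) ≤ k+1. So g is a γ_[kR]-function with g(v) = 0.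
-- A γ_[kR]-function exists because only the finitely many functions bounded by k+1 compete.

open import Defs renaming (sym to adj-sym)

open import Data.Bool using (true; false; not; if_then_else_)
open import Data.Bool.Properties using (if-eta; not-¬) renaming (_≟_ to _≟ᵇ_)
open import Data.Empty using (⊥-elim)
open import Data.Fin using (Fin; zero; suc; toℕ; fromℕ<; punchIn; punchOut; _≟_)
open import Data.Fin.Properties using (punchInᵢ≢i; punchIn-punchOut; toℕ-fromℕ<; any?; all?)
open import Data.List as List using (List; []; _∷_; map; allFin; filter)
open import Data.List.Extrema.Nat using (argmin; argmin-sel; f[argmin]≤f[xs])
open import Data.List.Membership.Propositional using (_∈_)
open import Data.List.Membership.Propositional.Properties using (∈-map⁺; ∈-allFin; ∈-filter⁺; ∈-filter⁻)
open import Data.List.Properties using (map-cong; map-tabulate)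
open import Data.List.Relation.Unary.All as All using ()
open import Data.Nat as ℕ using (ℕ; zero; suc; _+_; _^_; _⊓_; _≤_; _<_; _<?_; _≤?_; s≤s; z≤n)
open import Data.Nat.ListAction using () renaming (sum to sumᴸ)
open import Data.Nat.Properties
  using (+-0-commutativeMonoid; +-commutativeSemigroup; +-identityʳ; +-comm; +-cancelʳ-≤; +-mono-≤;
         m≤m+n; ≤-refl; ≤-reflexive; ≤-trans; 1+n≰n; <-asym; n<1+n; 0≢1+n; module ≤-Reasoning)
open import Data.Nat.Tactic.RingSolver using (solve)
open import Data.Product using (∃; _×_; _,_; proj₂)
open import Data.Sum using (inj₁; inj₂)
open import Data.Vec using (Vec; lookup; tabulate)
open import Data.Vec.Functional using (updateAt; removeAt)
open import Data.Vec.Functional.Properties using (updateAt-updates; updateAt-minimal)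
open import Data.Vec.Properties using (lookup∘tabulate)
open import Data.Vec.Recursive using (Fin[m^n]↔Fin[m]^n)
open import Data.Vec.Recursive.Properties using (↔Vec)
open import Function using (_∘_; const; Inverse; _↔_)
open import Function.Properties.Inverse using (↔-trans)
open import Relation.Binary.PropositionalEquality
  using (_≡_; _≢_; refl; sym; trans; cong; cong₂; subst; subst₂; _≗_; module ≡-Reasoning)
open import Relation.Nullary using (yes; no)
open import Relation.Nullary.Decidable using (⌊_⌋; map′; _×-dec_; _→-dec_)
open import Relation.Unary using (Decidable)

open import Algebra.Properties.CommutativeMonoid.Sum +-0-commutativeMonoid
  using (sum; sum-remove; sum-cong-≗; sum-replicate-zero)
open import Algebra.Properties.CommutativeSemigroup +-commutativeSemigroup using (xy∙z≈zy∙x)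

ΣV≡sum : ∀ {n} (t : Fin n → ℕ) → ΣV t ≡ sum t
ΣV≡sum t = trans (cong sumᴸ (map-tabulate (λ i → i) t)) (sumᴸ-tabulate t)
  where
  sumᴸ-tabulate : ∀ {m} (s : Fin m → ℕ) → sumᴸ (List.tabulate s) ≡ sum s
  sumᴸ-tabulate {zero}  s = refl
  sumᴸ-tabulate {suc m} s = cong (s zero +_) (sumᴸ-tabulate (s ∘ suc))

ΣV-cong : ∀ {n} {t t′ : Fin n → ℕ} → t ≗ t′ → ΣV t ≡ ΣV t′
ΣV-cong {n} t≗t′ = cong sumᴸ (map-cong t≗t′ (allFin n))

ΣV-zero : ∀ n → ΣV {n} (const 0) ≡ 0
ΣV-zero n = trans (ΣV≡sum {n} (const 0)) (sum-replicate-zero n)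

ΣV-remove : ∀ {n} (t : Fin (suc n) → ℕ) i → ΣV t ≡ t i + sum (removeAt t i)
ΣV-remove t i = trans (ΣV≡sum t) (sum-remove {i = i} t)

ΣV-exchange : ∀ {n} {t t′ : Fin n → ℕ} i → (∀ j → j ≢ i → t j ≡ t′ j) → ΣV t + t′ i ≡ ΣV t′ + t i
ΣV-exchange {suc n} {t} {t′} i agree = begin
  ΣV t + t′ i                       ≡⟨ cong (_+ t′ i) (ΣV-remove t i) ⟩
  t i + sum (removeAt t i) + t′ i   ≡⟨ cong (λ r → t i + r + t′ i) (sum-cong-≗ agree-off-i) ⟩
  t i + sum (removeAt t′ i) + t′ i  ≡⟨ xy∙z≈zy∙x (t i) _ (t′ i) ⟩
  t′ i + sum (removeAt t′ i) + t i  ≡⟨ cong (_+ t i) (ΣV-remove t′ i) ⟨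
  ΣV t′ + t i                       ∎
  where
  open ≡-Reasoning
  agree-off-i : removeAt t i ≗ removeAt t′ i
  agree-off-i j = agree (punchIn i j) (punchInᵢ≢i i j)

ΣV-updateAt : ∀ {n} (t : Fin n → ℕ) i c → ΣV (updateAt t i (const c)) + t i ≡ ΣV t + c
ΣV-updateAt t i c = subst (λ x → ΣV (updateAt t i (const c)) + t i ≡ ΣV t + x) (updateAt-updates i t)
  (ΣV-exchange i (λ j j≢i → updateAt-minimal j i t j≢i))

pair≤ΣV : ∀ {n} (t : Fin n → ℕ) {i j} → i ≢ j → t i + t j ≤ ΣV t
pair≤ΣV {suc n} t {i} {j} i≢j = begin
  t i + t j                                  ≡⟨ cong (λ x → t i + t x) (punchIn-punchOut i≢j) ⟨
  t i + removeAt t i (punchOut i≢j)          ≤⟨ +-mono-≤ ≤-refl (term≤sum (removeAt t i) (punchOut i≢j)) ⟩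
  t i + sum (removeAt t i)                   ≡⟨ ΣV-remove t i ⟨
  ΣV t                                       ∎
  where
  open ≤-Reasoning
  term≤sum : ∀ {m} (s : Fin m → ℕ) k → s k ≤ sum s
  term≤sum {suc m} s k = subst (s k ≤_) (sym (sum-remove {i = k} s)) (m≤m+n (s k) _)

Fin[m^n]↔Vec : ∀ m n → Fin (m ^ n) ↔ Vec (Fin m) n
Fin[m^n]↔Vec m n = ↔-trans (Fin[m^n]↔Fin[m]^n m n) (↔Vec n)

boundedFunctions : ℕ → (n : ℕ) → List (Fin n → ℕ)
boundedFunctions B n = map (λ i → toℕ ∘ lookup (Inverse.to (Fin[m^n]↔Vec (suc B) n) i)) (allFin (suc B ^ n))

boundedFunctions-complete : ∀ {B n} (h : Fin n → ℕ) → (∀ i → h i ≤ B) →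
                            ∃ λ h′ → h′ ∈ boundedFunctions B n × h′ ≗ h
boundedFunctions-complete {B} {n} h h≤B = _ , ∈-map⁺ _ (∈-allFin (from code)) , decodes
  where
  open Inverse (Fin[m^n]↔Vec (suc B) n)
  code : Vec (Fin (suc B)) n
  code = tabulate (λ i → fromℕ< (s≤s (h≤B i)))
  decodes : toℕ ∘ lookup (to (from code)) ≗ h
  decodes i = begin
    toℕ (lookup (to (from code)) i)  ≡⟨ cong (λ c → toℕ (lookup c i)) (strictlyInverseˡ code) ⟩
    toℕ (lookup code i)              ≡⟨ cong toℕ (lookup∘tabulate _ i) ⟩
    toℕ (fromℕ< (s≤s (h≤B i)))       ≡⟨ toℕ-fromℕ< _ ⟩
    h i                              ∎
    where open ≡-Reasoning

weight-minimiser : ∀ {n} B (P : (Fin n → ℕ) → Set) → Decidable P →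
                   (∀ {h h′} → h ≗ h′ → P h → P h′) → (∀ {h} → P h → ∀ i → h i ≤ B) → ∀ {h₀} → P h₀ →
                   ∃ λ f → P f × (∀ h → P h → weight f ≤ weight h)
weight-minimiser {n} B P P? P-resp P-bounded {h₀} Ph₀ = f , Pf , f-minimal
  where
  candidates : List (Fin n → ℕ)
  candidates = filter P? (boundedFunctions B n)
  f : Fin n → ℕ
  f = argmin weight h₀ candidates
  Pf : P f
  Pf with argmin-sel weight h₀ candidates
  ... | inj₁ f≡h₀ = subst P (sym f≡h₀) Ph₀
  ... | inj₂ f∈   = proj₂ (∈-filter⁻ P? {xs = boundedFunctions B n} f∈)
  f-minimal : ∀ h → P h → weight f ≤ weight h
  f-minimal h Ph with boundedFunctions-complete h (P-bounded Ph)
  ... | h′ , h′∈ , h′≗h = subst (weight f ≤_) (ΣV-cong h′≗h)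
    (All.lookup (f[argmin]≤f[xs] h₀ candidates) (∈-filter⁺ P? h′∈ (P-resp (sym ∘ h′≗h) Ph)))

if-then-cong : ∀ b {x y z : ℕ} → (b ≡ true → x ≡ y) → (if b then x else z) ≡ (if b then y else z)
if-then-cong true  x≡y = x≡y refl
if-then-cong false _   = refl

K₂ : Graph 2
K₂ = record { adj = λ x y → not ⌊ x ≟ y ⌋ ; sym = distinct-sym ; irrefl = distinct-irrefl }
  where
  distinct-sym : ∀ x y → not ⌊ x ≟ y ⌋ ≡ not ⌊ y ≟ x ⌋
  distinct-sym zero       zero       = refl
  distinct-sym zero       (suc zero) = refl
  distinct-sym (suc zero) zero       = refl
  distinct-sym (suc zero) (suc zero) = refl
  distinct-irrefl : ∀ x → not ⌊ x ≟ x ⌋ ≡ false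
  distinct-irrefl zero       = refl
  distinct-irrefl (suc zero) = refl

-- activeNbrs counts through an indicator function local to Defs, which cannot be named here.
-- On K₂ the count at vertex 0 reduces to that indicator applied to m (plus 0); since the
-- indicator does not use its module parameters, conversion identifies this occurrence with the
-- one inside activeNbrs G f w for every G, f and w.
activeNbrs-K₂ : ∀ m → activeNbrs K₂ (const m) zero ≡ 1 ⊓ m
activeNbrs-K₂ zero    = refl
activeNbrs-K₂ (suc m) = refl

DominatedAt : ∀ {n} → Graph n → ℕ → (Fin n → ℕ) → Fin n → Set
DominatedAt G k f w = k + activeNbrs G f w ≤ fClosedNbhd G f w

record SoleNeighbour {n} (G : Graph n) (v u : Fin n) : Set where
  field
    adjacent : adj G v u ≡ true
    unique   : ∀ x → adj G v x ≡ true → x ≡ u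

module _ {n} (G : Graph n) where

  ΣN-cong : ∀ w {h h′ : Fin n → ℕ} → (∀ x → adj G w x ≡ true → h x ≡ h′ x) → ΣN G w h ≡ ΣN G w h′
  ΣN-cong w agree = ΣV-cong (λ x → if-then-cong (adj G w x) (agree x))

  ΣN-zero : ∀ w → ΣN G w (const 0) ≡ 0
  ΣN-zero w = trans (ΣV-cong (λ x → if-eta (adj G w x))) (ΣV-zero n)

  ΣN-exchange : ∀ w {h h′ : Fin n → ℕ} {a} → adj G w a ≡ true →
                (∀ x → adj G w x ≡ true → x ≢ a → h x ≡ h′ x) → ΣN G w h + h′ a ≡ ΣN G w h′ + h a
  ΣN-exchange w {h} {h′} {a} w∼a agree = subst₂ (λ x y → ΣN G w h + x ≡ ΣN G w h′ + y)
    (masked h′) (masked h)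
    (ΣV-exchange a (λ x x≢a → if-then-cong (adj G w x) (λ w∼x → agree x w∼x x≢a)))
    where
    masked : ∀ (h″ : Fin n → ℕ) → (if adj G w a then h″ a else 0) ≡ h″ a
    masked h″ = cong (λ b → if b then h″ a else 0) w∼a

  activeNbrs≡ΣN : ∀ f w → activeNbrs G f w ≡ ΣN G w (λ x → 1 ⊓ f x)
  activeNbrs≡ΣN f w = ΣN-cong w (λ x _ → trans (sym (+-identityʳ _)) (activeNbrs-K₂ (f x)))

  activeNbrs-cong : ∀ w {h h′ : Fin n → ℕ} → (∀ x → adj G w x ≡ true → h x ≡ h′ x) →
                    activeNbrs G h w ≡ activeNbrs G h′ w
  activeNbrs-cong w {h} {h′} agree = begin
    activeNbrs G h w             ≡⟨ activeNbrs≡ΣN h w ⟩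
    ΣN G w (λ x → 1 ⊓ h x)       ≡⟨ ΣN-cong w (λ x w∼x → cong (1 ⊓_) (agree x w∼x)) ⟩
    ΣN G w (λ x → 1 ⊓ h′ x)      ≡⟨ activeNbrs≡ΣN h′ w ⟨
    activeNbrs G h′ w            ∎
    where open ≡-Reasoning

  dominatedAt-cong : ∀ {k w} {h h′ : Fin n → ℕ} → h w ≡ h′ w →
                     (∀ x → adj G w x ≡ true → h x ≡ h′ x) → DominatedAt G k h w → DominatedAt G k h′ w
  dominatedAt-cong {k} {w} hw≡h′w agree =
    subst₂ _≤_ (cong (k +_) (activeNbrs-cong w agree)) (cong₂ _+_ hw≡h′w (ΣN-cong w agree))

  leaf⇒soleNeighbour : ∀ {v} → IsLeaf G v → ∃ (SoleNeighbour G v)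
  leaf⇒soleNeighbour {v} leaf with any? (λ x → adj G v x ≟ᵇ true)
  ... | no no-neighbour = ⊥-elim (0≢1+n (trans (sym degree≡0) leaf))
    where
    degree≡0 : degree G v ≡ 0
    degree≡0 = trans (ΣN-cong v (λ x v∼x → ⊥-elim (no-neighbour (x , v∼x)))) (ΣN-zero v)
  ... | yes (u , v∼u) = u , record { adjacent = v∼u ; unique = only-u }
    where
    indicator : ∀ {x} → adj G v x ≡ true → (if adj G v x then 1 else 0) ≡ 1
    indicator = cong (λ b → if b then 1 else 0)
    only-u : ∀ x → adj G v x ≡ true → x ≡ u
    only-u x v∼x with x ≟ u
    ... | yes x≡u = x≡u
    ... | no x≢u  = ⊥-elim (1+n≰n (subst₂ (λ a b → a + b ≤ 1) (indicator v∼x) (indicator v∼u)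
                                          (subst (_ ≤_) leaf (pair≤ΣV _ x≢u))))

  ΣN-sole : ∀ {v u} → SoleNeighbour G v u → ∀ h → ΣN G v h ≡ h u
  ΣN-sole {v} {u} sole h = begin
    ΣN G v h                   ≡⟨ +-identityʳ _ ⟨
    ΣN G v h + 0               ≡⟨ ΣN-exchange v adjacent (λ x v∼x x≢u → ⊥-elim (x≢u (unique x v∼x))) ⟩
    ΣN G v (const 0) + h u     ≡⟨ cong (_+ h u) (ΣN-zero v) ⟩
    h u                        ∎
    where
    open ≡-Reasoning
    open SoleNeighbour sole

  IsKRDF? : ∀ k → Decidable (IsKRDF G k)
  IsKRDF? k f = map′ (λ (b , d) → record { bounded = b ; dominates = d })
                     (λ r → IsKRDF.bounded r , IsKRDF.dominates r)
                     (all? (λ v → f v ≤? suc k)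
                       ×-dec all? (λ v → f v <? k →-dec k + activeNbrs G f v ≤? fClosedNbhd G f v))

  IsKRDF-resp : ∀ {k} {h h′ : Fin n → ℕ} → h ≗ h′ → IsKRDF G k h → IsKRDF G k h′
  IsKRDF-resp {k} h≗h′ h-rdf = record
    { bounded   = λ v → subst (_≤ suc k) (h≗h′ v) (IsKRDF.bounded h-rdf v)
    ; dominates = λ v h′v<k → dominatedAt-cong (h≗h′ v) (λ x _ → h≗h′ x)
                                (IsKRDF.dominates h-rdf v (subst (_< k) (sym (h≗h′ v)) h′v<k))
    }

  gammaKR-exists : ∀ k → ∃ (IsGammaKR G k)
  gammaKR-exists k with weight-minimiser (suc k) (IsKRDF G k) (IsKRDF? k) IsKRDF-resp IsKRDF.bounded all-top
    where
    all-top : IsKRDF G k (const (suc k))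
    all-top = record { bounded   = λ _ → ≤-refl
                     ; dominates = λ _ 1+k<k → ⊥-elim (<-asym (n<1+n k) 1+k<k) }
  ... | f , f-rdf , f-minimal = f , record { isRDF = f-rdf ; minimal = f-minimal }

m≤1+k⇒m≤k+1⊓m : ∀ {m k} → m ≤ suc k → m ≤ k + 1 ⊓ m
m≤1+k⇒m≤k+1⊓m {zero}      _     = z≤n
m≤1+k⇒m≤k+1⊓m {suc m} {k} m≤1+k = subst (suc m ≤_) (+-comm 1 k) m≤1+k

-- At a vertex w adjacent to u: A and S are the active-neighbour count and the neighbourhood sum
-- of w after (g) and before (f) the move, and a = f(u) with indicator p = min(1, a).
dominance-transfer : ∀ {k a p Ag Af Sg Sf F} → a ≤ k + p → Ag + p ≡ Af + 1 → Sg + a ≡ Sf + suc k →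
                     k + Af ≤ F + Sf → k + Ag ≤ F + Sg
dominance-transfer {k} {a} {p} {Ag} {Af} {Sg} {Sf} {F} a≤k+p A-exchange S-exchange dominated =
  +-cancelʳ-≤ (p + a) (k + Ag) (F + Sg) (begin
    k + Ag + (p + a)        ≡⟨ solve (k ∷ Ag ∷ p ∷ a ∷ []) ⟩
    k + (Ag + p) + a        ≡⟨ cong (λ x → k + x + a) A-exchange ⟩
    k + (Af + 1) + a        ≡⟨ solve (k ∷ Af ∷ a ∷ []) ⟩
    k + Af + (1 + a)        ≤⟨ +-mono-≤ dominated (s≤s a≤k+p) ⟩
    F + Sf + (1 + (k + p))  ≡⟨ solve (F ∷ Sf ∷ k ∷ p ∷ []) ⟩
    F + (Sf + suc k) + p    ≡⟨ cong (λ x → F + x + p) S-exchange ⟨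
    F + (Sg + a) + p        ≡⟨ solve (F ∷ Sg ∷ a ∷ p ∷ []) ⟩
    F + Sg + (p + a)        ∎)
  where open ≤-Reasoning

module LeafToSupport {n} (G : Graph n) (k : ℕ) {v u : Fin n} (sole : SoleNeighbour G v u) where
  open SoleNeighbour sole

  u≢v : u ≢ v
  u≢v refl = not-¬ (irrefl G u) adjacent

  only-u-sees-v : ∀ {w} → adj G w v ≡ true → w ≡ u
  only-u-sees-v {w} w∼v = unique w (trans (adj-sym G v w) w∼v)

  shift : (Fin n → ℕ) → Fin n → ℕ
  shift f = updateAt (updateAt f u (const (suc k))) v (const 0)

  shift-v : ∀ f → shift f v ≡ 0
  shift-v f = updateAt-updates v _

  shift-u : ∀ f → shift f u ≡ suc k
  shift-u f = trans (updateAt-minimal u v _ u≢v) (updateAt-updates u f)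

  shift-off : ∀ f {x} → x ≢ v → x ≢ u → shift f x ≡ f x
  shift-off f x≢v x≢u = trans (updateAt-minimal _ v _ x≢v) (updateAt-minimal _ u f x≢u)

  weight-shift : ∀ f → f v ≡ suc k → weight (shift f) ≤ weight f
  weight-shift f fv≡1+k = +-cancelʳ-≤ (suc k) (weight (shift f)) (weight f) (begin
    weight (shift f) + suc k  ≡⟨ cong (weight (shift f) +_) f₁v≡1+k ⟨
    weight (shift f) + f₁ v   ≡⟨ ΣV-updateAt f₁ v 0 ⟩
    weight f₁ + 0             ≡⟨ +-identityʳ _ ⟩
    weight f₁                 ≤⟨ m≤m+n _ (f u) ⟩
    weight f₁ + f u           ≡⟨ ΣV-updateAt f u (suc k) ⟩
    weight f + suc k          ∎)
    where
    open ≤-Reasoning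
    f₁ : Fin n → ℕ
    f₁ = updateAt f u (const (suc k))
    f₁v≡1+k : f₁ v ≡ suc k
    f₁v≡1+k = trans (updateAt-minimal v u f (u≢v ∘ sym)) fv≡1+k

  shift-exchange : ∀ f (φ : ℕ → ℕ) {w} → w ≢ u → adj G w u ≡ true →
                   ΣN G w (φ ∘ shift f) + φ (f u) ≡ ΣN G w (φ ∘ f) + φ (suc k)
  shift-exchange f φ {w} w≢u w∼u =
    subst (λ y → ΣN G w (φ ∘ shift f) + φ (f u) ≡ ΣN G w (φ ∘ f) + φ y) (shift-u f)
          (ΣN-exchange G w w∼u agree)
    where
    agree : ∀ x → adj G w x ≡ true → x ≢ u → φ (shift f x) ≡ φ (f x)
    agree x w∼x x≢u = cong φ (shift-off f (λ { refl → w≢u (only-u-sees-v w∼x) }) x≢u)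

  module _ (f : Fin n → ℕ) (f-rdf : IsKRDF G k f) where

    shift-dominated-at-v : DominatedAt G k (shift f) v
    shift-dominated-at-v = ≤-reflexive (begin
      k + activeNbrs G (shift f) v  ≡⟨ cong (k +_) (trans (activeNbrs≡ΣN G (shift f) v) (ΣN-sole G sole _)) ⟩
      k + 1 ⊓ shift f u             ≡⟨ cong (λ x → k + 1 ⊓ x) (shift-u f) ⟩
      k + 1                         ≡⟨ +-comm k 1 ⟩
      suc k                         ≡⟨ trans (ΣN-sole G sole (shift f)) (shift-u f) ⟨
      ΣN G v (shift f)              ≡⟨ cong (_+ ΣN G v (shift f)) (shift-v f) ⟨
      fClosedNbhd G (shift f) v     ∎)
      where open ≡-Reasoning

    shift-dominated-near-u : ∀ {w} → w ≢ v → w ≢ u → adj G w u ≡ true →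
                             DominatedAt G k f w → DominatedAt G k (shift f) w
    shift-dominated-near-u {w} w≢v w≢u w∼u f-dominated =
      subst₂ _≤_ (cong (k +_) (sym (activeNbrs≡ΣN G (shift f) w)))
                 (cong (_+ ΣN G w (shift f)) (sym (shift-off f w≢v w≢u)))
        (dominance-transfer (m≤1+k⇒m≤k+1⊓m (IsKRDF.bounded f-rdf u))
                            (shift-exchange f (1 ⊓_) w≢u w∼u)
                            (shift-exchange f (λ x → x) w≢u w∼u)
                            (subst (λ A → k + A ≤ fClosedNbhd G f w) (activeNbrs≡ΣN G f w) f-dominated))

    shift-dominated-away : ∀ {w} → w ≢ v → w ≢ u → adj G w u ≡ false →
                           DominatedAt G k f w → DominatedAt G k (shift f) w
    shift-dominated-away {w} w≢v w≢u w≁u = dominatedAt-cong G (sym (shift-off f w≢v w≢u)) agree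
      where
      agree : ∀ x → adj G w x ≡ true → f x ≡ shift f x
      agree x w∼x = sym (shift-off f (λ { refl → w≢u (only-u-sees-v w∼x) })
                                     (λ { refl → not-¬ w≁u w∼x }))

    shift-dominated-off : ∀ {w} → w ≢ v → w ≢ u → DominatedAt G k f w → DominatedAt G k (shift f) w
    shift-dominated-off {w} w≢v w≢u with adj G w u in w∼u
    ... | true  = shift-dominated-near-u w≢v w≢u w∼u
    ... | false = shift-dominated-away w≢v w≢u w∼u

    shift-isKRDF : IsKRDF G k (shift f)
    shift-isKRDF = record { bounded = bounded ; dominates = dominates }
      where
      bounded : ∀ x → shift f x ≤ suc k
      bounded x with x ≟ v | x ≟ u
      ... | yes refl | _        = subst (_≤ suc k) (sym (shift-v f)) z≤n
      ... | no _     | yes refl = ≤-reflexive (shift-u f)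
      ... | no x≢v   | no x≢u   = subst (_≤ suc k) (sym (shift-off f x≢v x≢u)) (IsKRDF.bounded f-rdf x)
      dominates : ∀ w → shift f w < k → DominatedAt G k (shift f) w
      dominates w gw<k with w ≟ v | w ≟ u
      ... | yes refl | _        = shift-dominated-at-v
      ... | no _     | yes refl = ⊥-elim (<-asym (n<1+n k) (subst (_< k) (shift-u f) gw<k))
      ... | no w≢v   | no w≢u   =
        shift-dominated-off w≢v w≢u (IsKRDF.dominates f-rdf w (subst (_< k) (shift-off f w≢v w≢u) gw<k))

  shift-isGammaKR : ∀ {f} → IsGammaKR G k f → f v ≡ suc k → IsGammaKR G k (shift f)
  shift-isGammaKR {f} f-γ fv≡1+k = record
    { isRDF   = shift-isKRDF f (IsGammaKR.isRDF f-γ)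
    ; minimal = λ h h-rdf → ≤-trans (weight-shift f fv≡1+k) (IsGammaKR.minimal f-γ h h-rdf)
    }

-- The hypotheses k ≥ 1, n ≥ 3 and connectivity are unused: the move works at any leaf of any graph.
proposition2p2 : (k : ℕ) → 1 ≤ k → (n : ℕ) → 3 ≤ n → (G : Graph n) → Connected G →
    (v : Fin n) → IsLeaf G v →
    ∃ λ (f : Fin n → ℕ) → IsGammaKR G k f × f v ≢ suc k
proposition2p2 k _ n _ G _ v leaf with gammaKR-exists G k | leaf⇒soleNeighbour G leaf
... | f , f-γ | u , sole with f v ℕ.≟ suc k
...   | no fv≢1+k  = f , f-γ , fv≢1+k
...   | yes fv≡1+k = shift f , shift-isGammaKR f-γ fv≡1+k ,
                   λ shift-fv≡1+k → 0≢1+n (trans (sym (shift-v f)) shift-fv≡1+k)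
  where open LeafToSupport G k sole
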